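{- Let $\mathcal{T}$ be a finite rooted tree (a taxonomy tree). For nodes $x,y$ of $\mathcal{T}$ define $d_{wp}(x,y) = 1 - \frac{2\,c_{xy}}{c_x + c_y}$. Then $d_{wp}$ is a metric on the set of nodes of $\mathcal{T}$: it is symmetric, $d_{wp}(x,y)=0$ if and only if $x=y$, and $d_{wp}(x,z) \le d_{wp}(x,y) + d_{wp}(y,z)$ for all nodes $x,y,z$.
   Context: For a node $x$ of $\mathcal{T}$, its depth $c_x$ is the number of nodes on the path from the root to $x$, both endpoints included (so the root has depth $1$). For nodes $x,y$, $c_{xy}$ is the depth of the common ancestor of $x$ and $y$ that is farthest from the root, where every node is considered an ancestor of itself. -}

module Defs where

open import Data.Nat using (ℕ; zero; suc; _+_; _*_)
open import Data.Fin using (Fin; _≟_)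
open import Data.List using (List; length; lookup)
open import Data.Integer using (+_)
open import Data.Rational using (ℚ; _/_; _-_; 1ℚ)
open import Relation.Nullary using (yes; no)
open import Relation.Binary.PropositionalEquality using (refl)

data Tree : Set where
  node : List Tree → Tree

-- The nodes of a tree, identified with their (unique) path from the root:
-- 'root' is the root, 'child i p' is the node p inside the i-th subtree.
data Node : Tree → Set where
  root  : ∀ {ts} → Node (node ts)
  child : ∀ {ts} (i : Fin (length ts)) → Node (lookup ts i) → Node (node ts)

height : ∀ {t} → Node t → ℕ
height root        = zero
height (child i p) = suc (height p)

-- c_x : number of nodes on the path root..x (root has depth 1)
depth : ∀ {t} → Node t → ℕ
depth x = suc (height x)

-- number of edges from the root to the deepest common ancestor of x and y
-- (the common ancestors of x,y are exactly the common prefixes of their paths)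
lcaHeight : ∀ {t} → Node t → Node t → ℕ
lcaHeight root        _           = zero
lcaHeight (child i p) root        = zero
lcaHeight (child i p) (child j q) with i ≟ j
... | yes refl = suc (lcaHeight p q)
... | no _     = zero

lcaDepth : ∀ {t} → Node t → Node t → ℕ
lcaDepth x y = suc (lcaHeight x y)

-- Wu–Palmer distance  d_wp(x,y) = 1 - 2 c_xy / (c_x + c_y)
-- (c_x + c_y = suc (height x + depth y) is definitionally nonzero)
dwp : ∀ {t} → Node t → Node t → ℚ
dwp x y = 1ℚ - (+ (2 * lcaDepth x y)) / (depth x + depth y)

-- For the triangle inequality the tree enters only through the ultrametric
-- property of common ancestors, c_xz ≥ min (c_xy, c_yz). By symmetry we may
-- assume c_xy ≤ c_yz, so c_xz ≥ c_xy, and d(x,z) only grows if c_xz is lowered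
-- to c_xy. Clearing denominators, what remains is a polynomial inequality in
-- c_xy ≤ c_yz ≤ c_y, c_z and c_xy ≤ c_x; substituting the gaps
-- c_yz = c_xy + k, c_x = c_xy + α, c_y = c_yz + β, c_z = c_yz + γ turns it
-- into an identity whose remainder is a polynomial with nonnegative coefficients.
module Submission where

open import Defs
open import Data.Product using (_×_; _,_)
open import Data.Rational using (_≤_; _+_; 0ℚ)
open import Function.Bundles using (_⇔_)
open import Relation.Binary.PropositionalEquality using (_≡_)

open import Data.Nat as ℕ using (ℕ; suc; _*_; _⊓_; s≤s; z≤n)
import Data.Nat.Properties as ℕP
import Data.Nat.Tactic.RingSolver as ℕ-Ring
open import Data.Integer as ℤ using (+_; 1ℤ; 0ℤ)
import Data.Integer.Properties as ℤP
import Data.Integer.Tactic.RingSolver as ℤ-Ring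
open import Data.Rational as ℚ using (1ℚ; toℚᵘ; _-_; _/_)
import Data.Rational.Properties as ℚP
open import Data.Rational.Unnormalised as ℚᵘ using (mkℚᵘ; 1ℚᵘ; *≤*; *≡*; _≃_)
import Data.Rational.Unnormalised.Properties as ℚᵘP
open import Data.Fin using (Fin; _≟_)
open import Data.List using (length; lookup)
open import Data.Sum using (inj₁; inj₂)
open import Data.Empty using (⊥-elim)
open import Function.Bundles using (mk⇔)
import Function.Properties.Equivalence as ⇔
open import Relation.Nullary using (yes; no)
open import Relation.Binary.PropositionalEquality
  using (refl; sym; trans; cong; cong₂; subst; subst₂; module ≡-Reasoning)

-- ℚ is normalised, so fractions are compared after moving to ℚᵘ, where
-- addition and the order are computed on the raw numerators and denominators.

toℚᵘ-1-k/s : ∀ k d → toℚᵘ (1ℚ - + k / suc d) ≃ mkℚᵘ (+ suc d ℤ.- + k) d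
toℚᵘ-1-k/s k d = begin-equality
  toℚᵘ (1ℚ - + k / suc d)            ≃⟨ ℚP.toℚᵘ-homo-+ 1ℚ (ℚ.- (+ k / suc d)) ⟩
  1ℚᵘ ℚᵘ.+ toℚᵘ (ℚ.- (+ k / suc d))  ≃⟨ ℚᵘP.+-congʳ 1ℚᵘ (ℚP.toℚᵘ-homo‿- (+ k / suc d)) ⟩
  1ℚᵘ ℚᵘ.- toℚᵘ (+ k / suc d)        ≃⟨ ℚᵘP.+-congʳ 1ℚᵘ (ℚᵘP.-‿cong (ℚP.toℚᵘ-fromℚᵘ (mkℚᵘ (+ k) d))) ⟩
  1ℚᵘ ℚᵘ.- mkℚᵘ (+ k) d              ≃⟨ *≡* (cross-multiplied (+ k) (+ suc d)) ⟩
  mkℚᵘ (+ suc d ℤ.- + k) d           ∎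
  where
  open ℚᵘP.≤-Reasoning
  cross-multiplied : ∀ K S → (1ℤ ℤ.* S ℤ.+ ℤ.- K ℤ.* 1ℤ) ℤ.* S ≡ (S ℤ.- K) ℤ.* (1ℤ ℤ.* S)
  cross-multiplied = ℤ-Ring.solve-∀

1-k/s≡0⇔k≡s : ∀ k d → (1ℚ - + k / suc d ≡ 0ℚ) ⇔ (k ≡ suc d)
1-k/s≡0⇔k≡s k d = mk⇔ to from
  where
  to : 1ℚ - + k / suc d ≡ 0ℚ → k ≡ suc d
  to eq = sym (ℤP.+-injective (ℤP.i-j≡0⇒i≡j (+ suc d) (+ k)
    (ℚᵘP.p≃0⇒↥p≡0 _ (ℚᵘP.≃-trans (ℚᵘP.≃-sym (toℚᵘ-1-k/s k d)) (ℚP.toℚᵘ-cong eq)))))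
  from : k ≡ suc d → 1ℚ - + k / suc d ≡ 0ℚ
  from refl = ℚP.toℚᵘ-injective
    (ℚᵘP.≃-trans (toℚᵘ-1-k/s (suc d) d) (ℚᵘP.↥p≡0⇒p≃0 _ (ℤP.+-inverseʳ (+ suc d))))

cross-multiplied-≤ : ∀ K₁ K₂ K₃ S₁ S₂ S₃ →
  (K₂ ℤ.* S₃ ℤ.+ K₃ ℤ.* S₂) ℤ.* S₁ ℤ.≤ (S₁ ℤ.+ K₁) ℤ.* (S₂ ℤ.* S₃) →
  (S₁ ℤ.- K₁) ℤ.* (S₂ ℤ.* S₃) ℤ.≤ ((S₂ ℤ.- K₂) ℤ.* S₃ ℤ.+ (S₃ ℤ.- K₃) ℤ.* S₂) ℤ.* S₁
cross-multiplied-≤ K₁ K₂ K₃ S₁ S₂ S₃ le =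
  ℤP.0≤i-j⇒j≤i (subst (0ℤ ℤ.≤_) (same-gap K₁ K₂ K₃ S₁ S₂ S₃) (ℤP.i≤j⇒0≤j-i le))
  where
  same-gap : ∀ K₁ K₂ K₃ S₁ S₂ S₃ →
    (S₁ ℤ.+ K₁) ℤ.* (S₂ ℤ.* S₃) ℤ.- (K₂ ℤ.* S₃ ℤ.+ K₃ ℤ.* S₂) ℤ.* S₁ ≡
    ((S₂ ℤ.- K₂) ℤ.* S₃ ℤ.+ (S₃ ℤ.- K₃) ℤ.* S₂) ℤ.* S₁ ℤ.- (S₁ ℤ.- K₁) ℤ.* (S₂ ℤ.* S₃)
  same-gap = ℤ-Ring.solve-∀

1-k/s-triangle : ∀ k₁ k₂ k₃ d₁ d₂ d₃ → let s₁ = suc d₁ ; s₂ = suc d₂ ; s₃ = suc d₃ in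
  (k₂ * s₃ ℕ.+ k₃ * s₂) * s₁ ℕ.≤ (s₁ ℕ.+ k₁) * (s₂ * s₃) →
  1ℚ - + k₁ / s₁ ≤ (1ℚ - + k₂ / s₂) + (1ℚ - + k₃ / s₃)
1-k/s-triangle k₁ k₂ k₃ d₁ d₂ d₃ le = let open ℚᵘP.≤-Reasoning in ℚP.toℚᵘ-cancel-≤ (begin
  toℚᵘ (1ℚ - + k₁ / s₁)                                 ≃⟨ toℚᵘ-1-k/s k₁ d₁ ⟩
  mkℚᵘ (+ s₁ ℤ.- + k₁) d₁                               ≤⟨ *≤* cleared ⟩
  mkℚᵘ (+ s₂ ℤ.- + k₂) d₂ ℚᵘ.+ mkℚᵘ (+ s₃ ℤ.- + k₃) d₃  ≃⟨ ℚᵘP.+-cong (toℚᵘ-1-k/s k₂ d₂) (toℚᵘ-1-k/s k₃ d₃) ⟨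
  toℚᵘ (1ℚ - + k₂ / s₂) ℚᵘ.+ toℚᵘ (1ℚ - + k₃ / s₃)     ≃⟨ ℚP.toℚᵘ-homo-+ (1ℚ - + k₂ / s₂) (1ℚ - + k₃ / s₃) ⟨
  toℚᵘ ((1ℚ - + k₂ / s₂) + (1ℚ - + k₃ / s₃))           ∎)
  where
  s₁ = suc d₁ ; s₂ = suc d₂ ; s₃ = suc d₃
  cast : + ((k₂ * s₃ ℕ.+ k₃ * s₂) * s₁) ≡ (+ k₂ ℤ.* + s₃ ℤ.+ + k₃ ℤ.* + s₂) ℤ.* + s₁
  cast = begin
    + ((k₂ * s₃ ℕ.+ k₃ * s₂) * s₁)          ≡⟨ ℤP.pos-* (k₂ * s₃ ℕ.+ k₃ * s₂) s₁ ⟩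
    + (k₂ * s₃ ℕ.+ k₃ * s₂) ℤ.* + s₁         ≡⟨ cong (ℤ._* + s₁) (ℤP.pos-+ (k₂ * s₃) (k₃ * s₂)) ⟩
    (+ (k₂ * s₃) ℤ.+ + (k₃ * s₂)) ℤ.* + s₁   ≡⟨ cong (ℤ._* + s₁) (cong₂ ℤ._+_ (ℤP.pos-* k₂ s₃) (ℤP.pos-* k₃ s₂)) ⟩
    (+ k₂ ℤ.* + s₃ ℤ.+ + k₃ ℤ.* + s₂) ℤ.* + s₁ ∎
    where open ≡-Reasoning
  cleared : (+ s₁ ℤ.- + k₁) ℤ.* (+ s₂ ℤ.* + s₃) ℤ.≤ ((+ s₂ ℤ.- + k₂) ℤ.* + s₃ ℤ.+ (+ s₃ ℤ.- + k₃) ℤ.* + s₂) ℤ.* + s₁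
  cleared = cross-multiplied-≤ (+ k₁) (+ k₂) (+ k₃) (+ s₁) (+ s₂) (+ s₃) (subst (ℤ._≤ _) cast (ℤ.+≤+ le))

2*m≡a+b⇒a≡m : ∀ {m a b} → m ℕ.≤ a → m ℕ.≤ b → 2 * m ≡ a ℕ.+ b → a ≡ m
2*m≡a+b⇒a≡m {m} {a} {b} m≤a m≤b 2m≡a+b = ℕP.≤-antisym a≤m m≤a
  where
  open ℕP.≤-Reasoning
  a≤m : a ℕ.≤ m
  a≤m = ℕP.+-cancelʳ-≤ b a m (begin
    a ℕ.+ b      ≡⟨ 2m≡a+b ⟨
    2 * m        ≡⟨ cong (m ℕ.+_) (ℕP.+-identityʳ m) ⟩
    m ℕ.+ m      ≤⟨ ℕP.+-monoʳ-≤ m m≤b ⟩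
    m ℕ.+ b      ∎)

similarity-cross-multiplied-≤ : ∀ {m n p a b c} →
  m ℕ.≤ n → m ℕ.≤ p → m ℕ.≤ a → n ℕ.≤ b → n ℕ.≤ c →
  (2 * m * (b ℕ.+ c) ℕ.+ 2 * n * (a ℕ.+ b)) * (a ℕ.+ c) ℕ.≤ (a ℕ.+ c ℕ.+ 2 * p) * ((a ℕ.+ b) * (b ℕ.+ c))
similarity-cross-multiplied-≤ {m} {n} {p} {a} {b} {c} m≤n m≤p m≤a n≤b n≤c
  with k , refl ← ℕP.m≤n⇒∃[o]m+o≡n m≤n
  with α , refl ← ℕP.m≤n⇒∃[o]m+o≡n m≤a
  with β , refl ← ℕP.m≤n⇒∃[o]m+o≡n n≤b
  with γ , refl ← ℕP.m≤n⇒∃[o]m+o≡n n≤c = begin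
    (2 * m * (b ℕ.+ c) ℕ.+ 2 * n * (a ℕ.+ b)) * (a ℕ.+ c) ≤⟨ ℕP.≤-trans (ℕP.m≤m+n _ _) (ℕP.≤-reflexive (identity m k α β γ)) ⟩
    (a ℕ.+ c ℕ.+ 2 * m) * ((a ℕ.+ b) * (b ℕ.+ c))         ≤⟨ ℕP.*-monoˡ-≤ _ (ℕP.+-monoʳ-≤ (a ℕ.+ c) (ℕP.*-monoʳ-≤ 2 m≤p)) ⟩
    (a ℕ.+ c ℕ.+ 2 * p) * ((a ℕ.+ b) * (b ℕ.+ c))         ∎
  where
  open ℕP.≤-Reasoning
  identity : ∀ m k α β γ → let n = m ℕ.+ k ; a = m ℕ.+ α ; b = n ℕ.+ β ; c = n ℕ.+ γ in
    (2 * m * (b ℕ.+ c) ℕ.+ 2 * n * (a ℕ.+ b)) * (a ℕ.+ c)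
      ℕ.+ (β * ((a ℕ.+ b) * (a ℕ.+ c) ℕ.+ 2 * m * (b ℕ.+ c))
           ℕ.+ γ * (α * (a ℕ.+ m ℕ.+ b ℕ.+ c) ℕ.+ (k ℕ.+ β) * (k ℕ.+ γ)))
    ≡ (a ℕ.+ c ℕ.+ 2 * m) * ((a ℕ.+ b) * (b ℕ.+ c))
  identity = ℕ-Ring.solve-∀

lcaHeight-child : ∀ {ts} (i : Fin (length ts)) (p q : Node (lookup ts i)) →
  lcaHeight {node ts} (child i p) (child i q) ≡ suc (lcaHeight p q)
lcaHeight-child i p q with i ≟ i
... | yes refl = refl
... | no i≢i   = ⊥-elim (i≢i refl)

lcaHeight-comm : ∀ {t} (x y : Node t) → lcaHeight x y ≡ lcaHeight y x
lcaHeight-comm root        root        = refl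
lcaHeight-comm root        (child j q) = refl
lcaHeight-comm (child i p) root        = refl
lcaHeight-comm (child i p) (child j q) with i ≟ j
... | yes refl = trans (cong suc (lcaHeight-comm p q)) (sym (lcaHeight-child i q p))
... | no i≢j with j ≟ i
...   | yes refl = ⊥-elim (i≢j refl)
...   | no _     = refl

lcaHeight-self : ∀ {t} (x : Node t) → lcaHeight x x ≡ height x
lcaHeight-self root        = refl
lcaHeight-self (child i p) = trans (lcaHeight-child i p p) (cong suc (lcaHeight-self p))

lcaHeight≤heightˡ : ∀ {t} (x y : Node t) → lcaHeight x y ℕ.≤ height x
lcaHeight≤heightˡ root        y           = z≤n
lcaHeight≤heightˡ (child i p) root        = z≤n
lcaHeight≤heightˡ (child i p) (child j q) with i ≟ j
... | yes refl = s≤s (lcaHeight≤heightˡ p q)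
... | no _     = z≤n

lcaHeight≤heightʳ : ∀ {t} (x y : Node t) → lcaHeight x y ℕ.≤ height y
lcaHeight≤heightʳ x y = subst (ℕ._≤ height y) (lcaHeight-comm y x) (lcaHeight≤heightˡ y x)

lcaHeight-ultrametric : ∀ {t} (x y z : Node t) → lcaHeight x y ⊓ lcaHeight y z ℕ.≤ lcaHeight x z
lcaHeight-ultrametric root        y           z    = z≤n
lcaHeight-ultrametric (child i p) root        z    = z≤n
lcaHeight-ultrametric (child i p) (child j q) root = ℕP.m⊓n≤n _ 0
lcaHeight-ultrametric (child i p) (child j q) (child k r) with i ≟ j | j ≟ k
... | no _     | _        = z≤n
... | yes refl | no _     = z≤n
... | yes refl | yes refl =
  ℕP.≤-trans (s≤s (lcaHeight-ultrametric p q r)) (ℕP.≤-reflexive (sym (lcaHeight-child i p r)))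

height≡lcaHeight⇒≡ : ∀ {t} (x y : Node t) → height x ≡ lcaHeight x y → height y ≡ lcaHeight x y → x ≡ y
height≡lcaHeight⇒≡ root        root        _    _    = refl
height≡lcaHeight⇒≡ root        (child j q) _    ()
height≡lcaHeight⇒≡ (child i p) root        ()   _
height≡lcaHeight⇒≡ (child i p) (child j q) hx≡l hy≡l with i ≟ j
... | yes refl = cong (child i) (height≡lcaHeight⇒≡ p q (ℕP.suc-injective hx≡l) (ℕP.suc-injective hy≡l))
... | no _ with () ← hx≡l

2*lcaDepth≡depth+depth⇔≡ : ∀ {t} (x y : Node t) → (2 * lcaDepth x y ≡ depth x ℕ.+ depth y) ⇔ (x ≡ y)
2*lcaDepth≡depth+depth⇔≡ x y = mk⇔ to from
  where
  open ≡-Reasoning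
  lx : lcaDepth x y ℕ.≤ depth x
  lx = s≤s (lcaHeight≤heightˡ x y)
  ly : lcaDepth x y ℕ.≤ depth y
  ly = s≤s (lcaHeight≤heightʳ x y)
  to : 2 * lcaDepth x y ≡ depth x ℕ.+ depth y → x ≡ y
  to eq = height≡lcaHeight⇒≡ x y
    (ℕP.suc-injective (2*m≡a+b⇒a≡m lx ly eq))
    (ℕP.suc-injective (2*m≡a+b⇒a≡m ly lx (trans eq (ℕP.+-comm (depth x) (depth y)))))
  from : x ≡ y → 2 * lcaDepth x y ≡ depth x ℕ.+ depth y
  from refl = begin
    2 * lcaDepth x x       ≡⟨ cong (λ h → 2 * suc h) (lcaHeight-self x) ⟩
    2 * depth x            ≡⟨ cong (depth x ℕ.+_) (ℕP.+-identityʳ (depth x)) ⟩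
    depth x ℕ.+ depth x    ∎

-- depth x + depth y reduces to suc (height x + depth y), matching the
-- denominators suc d of the lemmas on 1 - k / suc d.
dwp-comm : ∀ {t} (x y : Node t) → dwp x y ≡ dwp y x
dwp-comm x y = cong₂ (λ k d → 1ℚ - + k / suc d)
  (cong (λ h → 2 * suc h) (lcaHeight-comm x y))
  (ℕP.suc-injective (ℕP.+-comm (depth x) (depth y)))

dwp≡0⇔≡ : ∀ {t} (x y : Node t) → (dwp x y ≡ 0ℚ) ⇔ (x ≡ y)
dwp≡0⇔≡ x y = ⇔.trans (1-k/s≡0⇔k≡s (2 * lcaDepth x y) (height x ℕ.+ depth y)) (2*lcaDepth≡depth+depth⇔≡ x y)

dwp-triangle-≤ : ∀ {t} (x y z : Node t) → lcaHeight x y ℕ.≤ lcaHeight y z → dwp x z ≤ dwp x y + dwp y z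
dwp-triangle-≤ x y z xy≤yz =
  1-k/s-triangle (2 * lcaDepth x z) (2 * lcaDepth x y) (2 * lcaDepth y z)
    (height x ℕ.+ depth z) (height x ℕ.+ depth y) (height y ℕ.+ depth z)
    (similarity-cross-multiplied-≤ {a = depth x} {b = depth y} {c = depth z}
      (s≤s xy≤yz) (s≤s xy≤xz)
      (s≤s (lcaHeight≤heightˡ x y)) (s≤s (lcaHeight≤heightˡ y z)) (s≤s (lcaHeight≤heightʳ y z)))
  where
  xy≤xz : lcaHeight x y ℕ.≤ lcaHeight x z
  xy≤xz = ℕP.≤-trans (ℕP.⊓-glb ℕP.≤-refl xy≤yz) (lcaHeight-ultrametric x y z)

dwp-triangle : ∀ {t} (x y z : Node t) → dwp x z ≤ dwp x y + dwp y z
dwp-triangle x y z with ℕP.≤-total (lcaHeight x y) (lcaHeight y z)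
... | inj₁ xy≤yz = dwp-triangle-≤ x y z xy≤yz
... | inj₂ yz≤xy = begin
  dwp x z            ≡⟨ dwp-comm x z ⟩
  dwp z x            ≤⟨ dwp-triangle-≤ z y x (subst₂ ℕ._≤_ (lcaHeight-comm y z) (lcaHeight-comm x y) yz≤xy) ⟩
  dwp z y + dwp y x  ≡⟨ cong₂ _+_ (dwp-comm z y) (dwp-comm y x) ⟩
  dwp y z + dwp x y  ≡⟨ ℚP.+-comm (dwp y z) (dwp x y) ⟩
  dwp x y + dwp y z  ∎
  where open ℚP.≤-Reasoning

lemma1 : (t : Tree) →
    (∀ (x y : Node t) → dwp x y ≡ dwp y x) ×
    (∀ (x y : Node t) → (dwp x y ≡ 0ℚ) ⇔ (x ≡ y)) ×
    (∀ (x y z : Node t) → dwp x z ≤ dwp x y + dwp y z)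
lemma1 t = dwp-comm , dwp≡0⇔≡ , dwp-triangle
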